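{- There exist sets $A\subseteq\Sigma^\ast$ that are not in the arithmetical hierarchy yet are $\mathrm{F_{REC}}$-rankable.
   Context: $\Sigma=\{0,1\}$, with $\Sigma^\ast$ ordered by length then lexicographically ($\epsilon<0<1<00<\cdots$). $\mathrm{F_{REC}}$ is the class of total recursive functions $\Sigma^\ast\to\Sigma^\ast$. A function $f$ is a ranking function for $A$ if $f$ is defined on all of $A$ and for every $x\in A$, if $x$ is the $i$th element of $A$ in this order then $f(x)$ is the $i$th string of $\Sigma^\ast$; no condition is imposed on $f$ outside $A$. $A$ is $\mathrm{F_{REC}}$-rankable if it has a ranking function in $\mathrm{F_{REC}}$. -}

module Defs where

open import Data.Nat using (ℕ; zero; suc; _+_; _*_; _∸_; _<_)
open import Data.Bool using (Bool; true; false)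
open import Data.Fin using (Fin)
open import Data.Vec using (Vec; []; _∷_; lookup)
open import Data.List using (List; []; _∷_; length)
open import Data.List.Membership.Propositional using (_∈_)
open import Data.List.Relation.Unary.All using (All)
open import Data.List.Relation.Unary.AllPairs using (AllPairs)
open import Data.Product using (Σ; ∃; ∃-syntax; _×_; _,_)
open import Data.Sum using (_⊎_)
open import Data.Unit using (⊤)
open import Relation.Nullary using (¬_)
open import Relation.Binary.PropositionalEquality using (_≡_)
open import Function.Bundles using (_⇔_)

-- Strings over Σ = {0,1}: lists of booleans (false = 0, true = 1).

Str : Set
Str = List Bool

data LexLt : Str → Str → Set where
  here  : ∀ {v w} → LexLt (false ∷ v) (true ∷ w)
  there : ∀ {b v w} → LexLt v w → LexLt (b ∷ v) (b ∷ w)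

_<ₛ_ : Str → Str → Set
v <ₛ w = (length v < length w) ⊎ ((length v ≡ length w) × LexLt v w)

-- "x is the i-th element of A" (0-indexed: i = number of elements of A
-- strictly before x).  Witnessed by the strictly increasing list of all
-- elements of A that precede x.
IsIth : (Str → Set) → Str → ℕ → Set
IsIth A x i =
  A x × Σ (List Str) λ ys →
    AllPairs _<ₛ_ ys × length ys ≡ i ×
    All (λ y → A y × y <ₛ x) ys ×
    (∀ y → A y → y <ₛ x → y ∈ ys)

Full : Str → Set
Full _ = ⊤

-- Standard numbering of Σ* (bijection onto ℕ in shortlex order):
-- w ↦ (value of the binary numeral 1w) - 1.

val : ℕ → Str → ℕ
val acc []          = acc
val acc (false ∷ w) = val (2 * acc) w
val acc (true ∷ w)  = val (suc (2 * acc)) w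

enc : Str → ℕ
enc w = val 1 w ∸ 1

data Code : ℕ → Set where
  zer  : ∀ {n} → Code n
  sucᶜ : Code 1
  proj : ∀ {n} → Fin n → Code n
  comp : ∀ {n m} → Code m → Vec (Code n) m → Code n
  prec : ∀ {n} → Code n → Code (suc (suc n)) → Code (suc n)
  mu   : ∀ {n} → Code (suc n) → Code n

mutual
  data Eval : ∀ {n} → Code n → Vec ℕ n → ℕ → Set where
    ev-zer  : ∀ {n} {v : Vec ℕ n} → Eval zer v 0
    ev-suc  : ∀ {x} → Eval sucᶜ (x ∷ []) (suc x)
    ev-proj : ∀ {n} {i : Fin n} {v} → Eval (proj i) v (lookup v i)
    ev-comp : ∀ {n m} {f : Code m} {gs : Vec (Code n) m} {v us y} →
              EvalAll gs v us → Eval f us y → Eval (comp f gs) v y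
    ev-prec0 : ∀ {n} {g : Code n} {h v y} →
               Eval g v y → Eval (prec g h) (0 ∷ v) y
    ev-precS : ∀ {n} {g : Code n} {h v k z y} →
               Eval (prec g h) (k ∷ v) z → Eval h (k ∷ z ∷ v) y →
               Eval (prec g h) (suc k ∷ v) y
    ev-mu   : ∀ {n} {f : Code (suc n)} {v y} →
              Eval f (y ∷ v) 0 →
              (∀ i → i < y → ∃[ z ] Eval f (i ∷ v) (suc z)) →
              Eval (mu f) v y

  data EvalAll : ∀ {n m} → Vec (Code n) m → Vec ℕ n → Vec ℕ m → Set where
    []  : ∀ {n} {v : Vec ℕ n} → EvalAll [] v []
    _∷_ : ∀ {n m} {g : Code n} {gs : Vec (Code n) m} {v y ys} →
          Eval g v y → EvalAll gs v ys → EvalAll (g ∷ gs) v (y ∷ ys)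

Total : ∀ {n} → Code n → Set
Total {n} c = (v : Vec ℕ n) → ∃[ y ] Eval c v y

IsFREC : (Str → Str) → Set
IsFREC f = Σ (Code 1) λ c → (w : Str) → Eval c (enc w ∷ []) (enc (f w))

IsRankingFunction : (Str → Str) → (Str → Set) → Set
IsRankingFunction f A =
  (x : Str) → A x → ∃[ i ] (IsIth A x i × IsIth Full (f x) i)

FRECRankable : (Str → Set) → Set
FRECRankable A = Σ (Str → Str) λ f → IsFREC f × IsRankingFunction f A

mutual
  AltΣ : (n : ℕ) → (Vec ℕ n → Set) → Set
  AltΣ zero    P = P []
  AltΣ (suc n) P = ∃[ y ] AltΠ n (λ ys → P (y ∷ ys))

  AltΠ : (n : ℕ) → (Vec ℕ n → Set) → Set
  AltΠ zero    P = P []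
  AltΠ (suc n) P = ∀ y → AltΣ n (λ ys → P (y ∷ ys))

InSigma : ℕ → (Str → Set) → Set
InSigma n A = Σ (Code (suc n)) λ c → Total c ×
  ((w : Str) → A w ⇔ AltΣ n (λ ys → Eval c (enc w ∷ ys) 0))

-- A is in the arithmetical hierarchy (every Πₙ / Δₙ set is Σₙ₊₁).
Arithmetical : (Str → Set) → Set
Arithmetical A = ∃[ n ] InSigma n A

-- Fix any predicate Φ on ℕ and let A contain the number 0 and exactly one
-- number from each pair {2u+1, 2u+2}: the second if Φ u holds, the first
-- otherwise.  Whatever Φ is, the member of the u-th pair has rank u+1, so the
-- ranking function does not depend on Φ and is primitive recursive.  Taking
-- Φ u to say that u numbers a Σₙ-definition which holds at 2u+1 diagonalises
-- against every Σₙ-definition of A: if u numbers a definition of A, then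
-- 2u+1 ∈ A iff ¬ Φ u iff 2u+1 ∉ A.
module Submission where

open import Defs
open import Data.Bool using (Bool; true; false)
open import Data.Empty using (⊥-elim)
open import Data.Fin using (toℕ) renaming (zero to fz; suc to fs)
open import Data.Fin.Properties using (toℕ-injective)
open import Data.List using (List; []; _∷_; length; reverse; _++_; _∷ʳ_; map)
open import Data.List.Properties
  using (unfold-reverse; reverse-involutive; length-++; length-map; ∷-injectiveʳ)
open import Data.List.Membership.Propositional using (_∈_)
open import Data.List.Membership.Propositional.Properties using (∈-++⁺ˡ; ∈-++⁺ʳ; ∈-map⁺)
open import Data.List.Relation.Unary.All as All using (All; []; _∷_)
import Data.List.Relation.Unary.All.Properties as Allₚ
open import Data.List.Relation.Unary.Any using (here)
open import Data.List.Relation.Unary.AllPairs as AllPairs using (AllPairs; []; _∷_)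
import Data.List.Relation.Unary.AllPairs.Properties as AllPairsₚ
open import Data.Nat using (ℕ; zero; suc; _+_; _*_; _^_; _≤_; _<_; z≤n; s≤s; s<s⁻¹)
open import Data.Nat.Properties
open import Data.Product using (Σ; ∃-syntax; _×_; _,_; proj₁; proj₂; map₁; map₂)
open import Data.Sum using (_⊎_; inj₁; inj₂)
import Data.Sum as Sum
open import Data.Unit using (⊤; tt)
open import Data.Vec using (Vec; []; _∷_)
open import Function using (_∘_; id)
open import Function.Bundles using (_⇔_; mk⇔; Equivalence)
open import Relation.Binary.Definitions using (tri<; tri≈; tri>)
open import Relation.Binary.PropositionalEquality
open import Relation.Nullary using (¬_; Dec; yes; no)
open import Relation.Nullary.Decidable.Core using (¬¬-excluded-middle)

bit : Bool → ℕ
bit false = 0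
bit true  = 1

bit≤1 : ∀ b → bit b ≤ 1
bit≤1 false = z≤n
bit≤1 true  = s≤s z≤n

val-∷ : ∀ acc b w → val acc (b ∷ w) ≡ val (bit b + 2 * acc) w
val-∷ acc false w = refl
val-∷ acc true  w = refl

*-double : ∀ m n → m * (2 * n) ≡ 2 * m * n
*-double m n = trans (sym (*-assoc m 2 n)) (cong (_* n) (*-comm m 2))

val-lower : ∀ w acc → acc * 2 ^ length w ≤ val acc w
val-lower []      acc = ≤-reflexive (*-identityʳ acc)
val-lower (b ∷ w) acc = begin
  acc * (2 * 2 ^ length w)          ≡⟨ *-double acc (2 ^ length w) ⟩
  2 * acc * 2 ^ length w            ≤⟨ *-monoˡ-≤ (2 ^ length w) (m≤n+m (2 * acc) (bit b)) ⟩
  (bit b + 2 * acc) * 2 ^ length w  ≤⟨ val-lower w (bit b + 2 * acc) ⟩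
  val (bit b + 2 * acc) w           ≡⟨ val-∷ acc b w ⟨
  val acc (b ∷ w)                   ∎
  where open ≤-Reasoning

val-upper : ∀ w acc → val acc w < suc acc * 2 ^ length w
val-upper []      acc = s≤s (≤-reflexive (sym (*-identityʳ acc)))
val-upper (b ∷ w) acc = begin-strict
  val acc (b ∷ w)                       ≡⟨ val-∷ acc b w ⟩
  val (bit b + 2 * acc) w               <⟨ val-upper w (bit b + 2 * acc) ⟩
  suc (bit b + 2 * acc) * 2 ^ length w  ≤⟨ *-monoˡ-≤ (2 ^ length w) digit-bound ⟩
  2 * suc acc * 2 ^ length w            ≡⟨ *-double (suc acc) (2 ^ length w) ⟨
  suc acc * (2 * 2 ^ length w)          ∎
  where
  open ≤-Reasoning
  digit-bound : suc (bit b + 2 * acc) ≤ 2 * suc acc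
  digit-bound = ≤-trans (s≤s (+-monoˡ-≤ (2 * acc) (bit≤1 b))) (≤-reflexive (sym (*-suc 2 acc)))

val-positive : ∀ w → 0 < val 1 w
val-positive w = ≤-trans (m^n>0 2 (length w))
  (≤-trans (≤-reflexive (sym (*-identityˡ (2 ^ length w)))) (val-lower w 1))

suc-enc : ∀ w → suc (enc w) ≡ val 1 w
suc-enc w = trans (+-comm 1 (enc w)) (m∸n+n≡m (val-positive w))

val-mono-length : ∀ {v w} → length v < length w → val 1 v < val 1 w
val-mono-length {v} {w} lt = begin-strict
  val 1 v             <⟨ val-upper v 1 ⟩
  2 ^ suc (length v)  ≤⟨ ^-monoʳ-≤ 2 lt ⟩
  2 ^ length w        ≡⟨ *-identityˡ (2 ^ length w) ⟨
  1 * 2 ^ length w    ≤⟨ val-lower w 1 ⟩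
  val 1 w             ∎
  where open ≤-Reasoning

val-mono-lex : ∀ {v w} → LexLt v w → length v ≡ length w → ∀ acc → val acc v < val acc w
val-mono-lex (here {v} {w}) eq acc = begin-strict
  val (2 * acc) v                      <⟨ val-upper v (2 * acc) ⟩
  suc (2 * acc) * 2 ^ length v         ≡⟨ cong (λ l → suc (2 * acc) * 2 ^ l) (suc-injective eq) ⟩
  suc (2 * acc) * 2 ^ length w         ≤⟨ val-lower w (suc (2 * acc)) ⟩
  val (suc (2 * acc)) w                ∎
  where open ≤-Reasoning
val-mono-lex (there {false} lt) eq acc = val-mono-lex lt (suc-injective eq) (2 * acc)
val-mono-lex (there {true}  lt) eq acc = val-mono-lex lt (suc-injective eq) (suc (2 * acc))

enc-mono-< : ∀ {v w} → v <ₛ w → enc v < enc w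
enc-mono-< {v} {w} lt = s<s⁻¹ (subst₂ _<_ (sym (suc-enc v)) (sym (suc-enc w)) (val-mono lt))
  where
  val-mono : v <ₛ w → val 1 v < val 1 w
  val-mono (inj₁ shorter)      = val-mono-length {v} {w} shorter
  val-mono (inj₂ (same , lex)) = val-mono-lex lex same 1

lex-trichotomy : ∀ v w → length v ≡ length w → LexLt v w ⊎ v ≡ w ⊎ LexLt w v
lex-trichotomy []          []          _  = inj₂ (inj₁ refl)
lex-trichotomy (false ∷ v) (true ∷ w)  _  = inj₁ here
lex-trichotomy (true ∷ v)  (false ∷ w) _  = inj₂ (inj₂ here)
lex-trichotomy (false ∷ v) (false ∷ w) eq = Sum.map there (Sum.map (cong (false ∷_)) there)
  (lex-trichotomy v w (suc-injective eq))
lex-trichotomy (true ∷ v)  (true ∷ w)  eq = Sum.map there (Sum.map (cong (true ∷_)) there)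
  (lex-trichotomy v w (suc-injective eq))

<ₛ-trichotomy : ∀ v w → v <ₛ w ⊎ v ≡ w ⊎ w <ₛ v
<ₛ-trichotomy v w with <-cmp (length v) (length w)
... | tri< shorter _ _ = inj₁ (inj₁ shorter)
... | tri> _ _ longer  = inj₂ (inj₂ (inj₁ longer))
... | tri≈ _ same _    with lex-trichotomy v w same
...   | inj₁ lex        = inj₁ (inj₂ (same , lex))
...   | inj₂ (inj₁ v≡w) = inj₂ (inj₁ v≡w)
...   | inj₂ (inj₂ lex) = inj₂ (inj₂ (inj₂ (sym same , lex)))

enc-injective : ∀ {v w} → enc v ≡ enc w → v ≡ w
enc-injective {v} {w} eq with <ₛ-trichotomy v w
... | inj₁ lt        = ⊥-elim (<-irrefl eq (enc-mono-< lt))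
... | inj₂ (inj₁ v≡w) = v≡w
... | inj₂ (inj₂ gt) = ⊥-elim (<-irrefl (sym eq) (enc-mono-< gt))

enc-cancel-< : ∀ {v w} → enc v < enc w → v <ₛ w
enc-cancel-< {v} {w} lt with <ₛ-trichotomy v w
... | inj₁ v<w          = v<w
... | inj₂ (inj₁ refl)  = ⊥-elim (<-irrefl refl lt)
... | inj₂ (inj₂ w<v)   = ⊥-elim (<-asym lt (enc-mono-< w<v))

-- Binary increment on numerals written least significant bit first.
inc : Str → Str
inc []          = false ∷ []
inc (false ∷ r) = true ∷ r
inc (true ∷ r)  = false ∷ inc r

val-++ : ∀ v w acc → val acc (v ++ w) ≡ val (val acc v) w
val-++ []          w acc = refl
val-++ (false ∷ v) w acc = val-++ v w (2 * acc)
val-++ (true ∷ v)  w acc = val-++ v w (suc (2 * acc))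

val-reverse-∷ : ∀ b r → val 1 (reverse (b ∷ r)) ≡ bit b + 2 * val 1 (reverse r)
val-reverse-∷ b r = begin
  val 1 (reverse (b ∷ r))          ≡⟨ cong (val 1) (unfold-reverse b r) ⟩
  val 1 (reverse r ++ b ∷ [])      ≡⟨ val-++ (reverse r) (b ∷ []) 1 ⟩
  val (val 1 (reverse r)) (b ∷ []) ≡⟨ val-∷ (val 1 (reverse r)) b [] ⟩
  bit b + 2 * val 1 (reverse r)    ∎
  where open ≡-Reasoning

val-reverse-inc : ∀ r → val 1 (reverse (inc r)) ≡ suc (val 1 (reverse r))
val-reverse-inc []          = refl
val-reverse-inc (false ∷ r) =
  trans (val-reverse-∷ true r) (cong suc (sym (val-reverse-∷ false r)))
val-reverse-inc (true ∷ r)  = begin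
  val 1 (reverse (false ∷ inc r))    ≡⟨ val-reverse-∷ false (inc r) ⟩
  2 * val 1 (reverse (inc r))        ≡⟨ cong (2 *_) (val-reverse-inc r) ⟩
  2 * suc (val 1 (reverse r))        ≡⟨ *-suc 2 (val 1 (reverse r)) ⟩
  suc (suc (2 * val 1 (reverse r)))  ≡⟨ cong suc (val-reverse-∷ true r) ⟨
  suc (val 1 (reverse (true ∷ r)))   ∎
  where open ≡-Reasoning

next : Str → Str
next w = reverse (inc (reverse w))

enc-next : ∀ w → enc (next w) ≡ suc (enc w)
enc-next w = suc-injective (begin
  suc (enc (next w))                 ≡⟨ suc-enc (next w) ⟩
  val 1 (reverse (inc (reverse w)))  ≡⟨ val-reverse-inc (reverse w) ⟩
  suc (val 1 (reverse (reverse w)))  ≡⟨ cong (suc ∘ val 1) (reverse-involutive w) ⟩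
  suc (val 1 w)                      ≡⟨ cong suc (suc-enc w) ⟨
  suc (suc (enc w))                  ∎)
  where open ≡-Reasoning

fromℕ : ℕ → Str
fromℕ zero    = []
fromℕ (suc k) = next (fromℕ k)

enc-fromℕ : ∀ k → enc (fromℕ k) ≡ k
enc-fromℕ zero    = refl
enc-fromℕ (suc k) = trans (enc-next (fromℕ k)) (cong suc (enc-fromℕ k))

fromℕ-enc : ∀ w → fromℕ (enc w) ≡ w
fromℕ-enc w = enc-injective (enc-fromℕ (enc w))

fromℕ-<ₛ : ∀ {i} w → i < enc w → fromℕ i <ₛ w
fromℕ-<ₛ {i} w lt = enc-cancel-< (subst (_< enc w) (sym (enc-fromℕ i)) lt)

record EnumBelow (P : ℕ → Set) (k : ℕ) (ns : List ℕ) : Set where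
  field
    ascending : AllPairs _<_ ns
    sound     : All (λ j → P j × j < k) ns
    complete  : ∀ j → P j → j < k → j ∈ ns

length-∷ʳ : ∀ {A : Set} (xs : List A) x → length (xs ∷ʳ x) ≡ suc (length xs)
length-∷ʳ xs x = trans (length-++ xs) (+-comm (length xs) 1)

module _ {P : ℕ → Set} where

  enumBelow-zero : EnumBelow P 0 []
  enumBelow-zero = record { ascending = [] ; sound = [] ; complete = λ _ _ () }

  enumBelow-skip : ∀ {k ns} → EnumBelow P k ns → ¬ P k → EnumBelow P (suc k) ns
  enumBelow-skip {k} {ns} e ¬pk = record
    { ascending = ascending
    ; sound     = All.map (map₂ m<n⇒m<1+n) sound
    ; complete  = complete′
    }
    where
    open EnumBelow e
    complete′ : ∀ j → P j → j < suc k → j ∈ ns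
    complete′ j pj j<1+k with m<1+n⇒m<n∨m≡n j<1+k
    ... | inj₁ j<k  = complete j pj j<k
    ... | inj₂ refl = ⊥-elim (¬pk pj)

  enumBelow-snoc : ∀ {k ns} → EnumBelow P k ns → P k → EnumBelow P (suc k) (ns ∷ʳ k)
  enumBelow-snoc {k} {ns} e pk = record
    { ascending = AllPairsₚ.++⁺ ascending ([] ∷ []) (All.map (λ (_ , j<k) → j<k ∷ []) sound)
    ; sound     = Allₚ.∷ʳ⁺ (All.map (map₂ m<n⇒m<1+n) sound) (pk , n<1+n k)
    ; complete  = complete′
    }
    where
    open EnumBelow e
    complete′ : ∀ j → P j → j < suc k → j ∈ ns ∷ʳ k
    complete′ j pj j<1+k with m<1+n⇒m<n∨m≡n j<1+k
    ... | inj₁ j<k  = ∈-++⁺ˡ (complete j pj j<k)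
    ... | inj₂ refl = ∈-++⁺ʳ ns (here refl)

  enumBelow-pair : ∀ {k ns} → EnumBelow P k ns →
                   (P k × ¬ P (suc k)) ⊎ (¬ P k × P (suc k)) →
                   ∃[ ns′ ] EnumBelow P (suc (suc k)) ns′ × length ns′ ≡ suc (length ns)
  enumBelow-pair {k} {ns} e (inj₁ (pk , ¬pk′)) =
    ns ∷ʳ k , enumBelow-skip (enumBelow-snoc e pk) ¬pk′ , length-∷ʳ ns k
  enumBelow-pair {k} {ns} e (inj₂ (¬pk , pk′)) =
    ns ∷ʳ suc k , enumBelow-snoc (enumBelow-skip e ¬pk) pk′ , length-∷ʳ ns (suc k)

  enumBelow⇒IsIth : ∀ {x ns} → P (enc x) → EnumBelow P (enc x) ns → IsIth (P ∘ enc) x (length ns)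
  enumBelow⇒IsIth {x} {ns} px e =
    px , map fromℕ ns ,
    AllPairsₚ.map⁺ (AllPairs.map ascending-fromℕ ascending) ,
    length-map fromℕ ns ,
    Allₚ.map⁺ (All.map (λ {j} (pj , j<x) → subst P (sym (enc-fromℕ j)) pj , fromℕ-<ₛ x j<x) sound) ,
    λ y py y<x → subst (_∈ map fromℕ ns) (fromℕ-enc y)
                   (∈-map⁺ fromℕ (complete (enc y) py (enc-mono-< y<x)))
    where
    open EnumBelow e
    ascending-fromℕ : ∀ {i j} → i < j → fromℕ i <ₛ fromℕ j
    ascending-fromℕ {i} {j} i<j = fromℕ-<ₛ (fromℕ j) (subst (i <_) (sym (enc-fromℕ j)) i<j)

enumBelow-all : ∀ k → ∃[ ns ] EnumBelow (λ _ → ⊤) k ns × length ns ≡ k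
enumBelow-all zero    = [] , enumBelow-zero , refl
enumBelow-all (suc k) with enumBelow-all k
... | ns , e , len = ns ∷ʳ k , enumBelow-snoc e tt , trans (length-∷ʳ ns k) (cong suc len)

IsIth-Full-fromℕ : ∀ r → IsIth Full (fromℕ r) r
IsIth-Full-fromℕ r with enumBelow-all (enc (fromℕ r))
... | ns , e , len = subst (IsIth Full (fromℕ r)) (trans len (enc-fromℕ r)) (enumBelow⇒IsIth tt e)

slot : Bool → ℕ → ℕ
slot b u = suc (bit b + 2 * u)

bit+2*-suc : ∀ b u → bit b + 2 * suc u ≡ suc (suc (bit b + 2 * u))
bit+2*-suc b u = begin
  bit b + 2 * suc u              ≡⟨ cong (bit b +_) (*-suc 2 u) ⟩
  bit b + suc (suc (2 * u))      ≡⟨ +-suc (bit b) (suc (2 * u)) ⟩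
  suc (bit b + suc (2 * u))      ≡⟨ cong suc (+-suc (bit b) (2 * u)) ⟩
  suc (suc (bit b + 2 * u))      ∎
  where open ≡-Reasoning

halve : ℕ → ℕ × Bool
halve zero          = 0 , false
halve (suc zero)    = 0 , true
halve (suc (suc m)) = map₁ suc (halve m)

halve-correct : ∀ m → bit (proj₂ (halve m)) + 2 * proj₁ (halve m) ≡ m
halve-correct zero          = refl
halve-correct (suc zero)    = refl
halve-correct (suc (suc m)) =
  trans (bit+2*-suc (proj₂ (halve m)) (proj₁ (halve m))) (cong (suc ∘ suc) (halve-correct m))

halve-slot : ∀ b u → halve (bit b + 2 * u) ≡ (u , b)
halve-slot false zero    = refl
halve-slot true  zero    = refl
halve-slot b     (suc u) = trans (cong halve (bit+2*-suc b u)) (cong (map₁ suc) (halve-slot b u))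

isZero : ℕ → ℕ
isZero zero    = 1
isZero (suc _) = 0

isEven : ℕ → ℕ
isEven zero    = 1
isEven (suc m) = isZero (isEven m)

rank : ℕ → ℕ
rank zero    = 0
rank (suc m) = isEven m + rank m

isEven-even : ∀ u → isEven (2 * u) ≡ 1
isEven-even zero    = refl
isEven-even (suc u) = trans (cong isEven (*-suc 2 u)) (cong (isZero ∘ isZero) (isEven-even u))

rank-even : ∀ u → rank (2 * u) ≡ u
rank-even zero    = refl
rank-even (suc u) = trans (cong rank (*-suc 2 u))
  (cong₂ _+_ (cong isZero (isEven-even u)) (cong₂ _+_ (isEven-even u) (rank-even u)))

rank-slot : ∀ b u → rank (slot b u) ≡ suc u
rank-slot false u = cong₂ _+_ (isEven-even u) (rank-even u)
rank-slot true  u = cong₂ _+_ (cong isZero (isEven-even u)) (rank-slot false u)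

ranking : Str → Str
ranking x = fromℕ (rank (enc x))

oneᶜ : Code 0
oneᶜ = comp sucᶜ (zer ∷ [])

isZeroᶜ : Code 1
isZeroᶜ = prec oneᶜ zer

isEvenᶜ : Code 1
isEvenᶜ = prec oneᶜ (comp isZeroᶜ (proj (fs fz) ∷ []))

addᶜ : Code 2
addᶜ = prec (proj fz) (comp sucᶜ (proj (fs fz) ∷ []))

rankᶜ : Code 1
rankᶜ = prec zer (comp addᶜ (comp isEvenᶜ (proj fz ∷ []) ∷ proj (fs fz) ∷ []))

Eval-oneᶜ : Eval oneᶜ [] 1
Eval-oneᶜ = ev-comp (ev-zer ∷ []) ev-suc

Eval-isZeroᶜ : ∀ k → Eval isZeroᶜ (k ∷ []) (isZero k)
Eval-isZeroᶜ zero    = ev-prec0 Eval-oneᶜ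
Eval-isZeroᶜ (suc k) = ev-precS (Eval-isZeroᶜ k) ev-zer

Eval-isEvenᶜ : ∀ k → Eval isEvenᶜ (k ∷ []) (isEven k)
Eval-isEvenᶜ zero    = ev-prec0 Eval-oneᶜ
Eval-isEvenᶜ (suc k) = ev-precS (Eval-isEvenᶜ k) (ev-comp (ev-proj ∷ []) (Eval-isZeroᶜ (isEven k)))

Eval-addᶜ : ∀ a b → Eval addᶜ (a ∷ b ∷ []) (a + b)
Eval-addᶜ zero    b = ev-prec0 ev-proj
Eval-addᶜ (suc a) b = ev-precS (Eval-addᶜ a b) (ev-comp (ev-proj ∷ []) ev-suc)

Eval-rankᶜ : ∀ k → Eval rankᶜ (k ∷ []) (rank k)
Eval-rankᶜ zero    = ev-prec0 ev-zer
Eval-rankᶜ (suc k) = ev-precS (Eval-rankᶜ k)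
  (ev-comp (ev-comp (ev-proj ∷ []) (Eval-isEvenᶜ k) ∷ ev-proj ∷ []) (Eval-addᶜ (isEven k) (rank k)))

ranking-FREC : IsFREC ranking
ranking-FREC = rankᶜ , λ w →
  subst (Eval rankᶜ (enc w ∷ [])) (sym (enc-fromℕ (rank (enc w)))) (Eval-rankᶜ (enc w))

¬[P⇔Q×¬P] : ∀ {P Q : Set} → ¬ ¬ Q → ¬ (P ⇔ (Q × ¬ P))
¬[P⇔Q×¬P] ¬¬q p⇔ = ¬¬q (λ q → ¬p (Equivalence.from p⇔ (q , ¬p)))
  where ¬p = λ p → proj₂ (Equivalence.to p⇔ p) p

SatΣ : Σ ℕ (λ n → Code (suc n)) → ℕ → Set
SatΣ (n , c) k = AltΣ n (λ ys → Eval c (k ∷ ys) 0)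

module Selection (Φ : ℕ → Set) where

  Decided : ℕ → Set
  Decided u = ∀ j → j < u → Dec (Φ j)

  Holds : Bool → ℕ → Set
  Holds true  u = Φ u
  Holds false u = ¬ Φ u

  -- Decided u is classically trivial; it is what lets the members below the
  -- u-th pair be listed, and ¬ ¬ Decided u still holds constructively.
  Selected : ℕ × Bool → Set
  Selected (u , b) = Decided u × Holds b u

  Member : ℕ → Set
  Member zero    = ⊤
  Member (suc m) = Selected (halve m)

  Chosen : Str → Set
  Chosen x = Member (enc x)

  Member-slot : ∀ b u → Member (slot b u) ≡ Selected (u , b)
  Member-slot b u = cong Selected (halve-slot b u)

  Member-slot⁺ : ∀ b u → Selected (u , b) → Member (slot b u)
  Member-slot⁺ b u = subst id (sym (Member-slot b u))

  ¬Member-slot-false : ∀ {u} → Φ u → ¬ Member (slot false u)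
  ¬Member-slot-false {u} φ m = proj₂ (subst id (Member-slot false u) m) φ

  ¬Member-slot-true : ∀ {u} → ¬ Φ u → ¬ Member (slot true u)
  ¬Member-slot-true {u} ¬φ m = ¬φ (proj₂ (subst id (Member-slot true u) m))

  Member-pair : ∀ u → Decided u → Dec (Φ u) →
                (Member (slot false u) × ¬ Member (slot true u)) ⊎
                (¬ Member (slot false u) × Member (slot true u))
  Member-pair u dec (yes φ)  = inj₂ (¬Member-slot-false φ , Member-slot⁺ true u (dec , φ))
  Member-pair u dec (no ¬φ)  = inj₁ (Member-slot⁺ false u (dec , ¬φ) , ¬Member-slot-true ¬φ)

  Decided-restrict : ∀ {u} → Decided (suc u) → Decided u
  Decided-restrict dec j j<u = dec j (m<n⇒m<1+n j<u)

  Decided-suc : ∀ {u} → Decided u → Dec (Φ u) → Decided (suc u)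
  Decided-suc dec d j j<1+u with m<1+n⇒m<n∨m≡n j<1+u
  ... | inj₁ j<u  = dec j j<u
  ... | inj₂ refl = d

  ¬¬Decided : ∀ u → ¬ ¬ Decided u
  ¬¬Decided zero    ¬dec = ¬dec (λ _ ())
  ¬¬Decided (suc u) ¬dec = ¬¬Decided u (λ dec → ¬¬-excluded-middle (¬dec ∘ Decided-suc dec))

  enumBelow-slot : ∀ u → Decided u → ∃[ ns ] EnumBelow Member (slot false u) ns × length ns ≡ suc u
  enumBelow-slot zero    _   = 0 ∷ [] , enumBelow-snoc enumBelow-zero tt , refl
  enumBelow-slot (suc u) dec with enumBelow-slot u (Decided-restrict dec)
  ... | ns , e , len with enumBelow-pair e (Member-pair u (Decided-restrict dec) (dec u (n<1+n u)))
  ...   | ns′ , e′ , len′ =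
    ns′ , subst (λ k → EnumBelow Member k ns′) (sym (cong suc (bit+2*-suc false u))) e′ ,
    trans len′ (cong suc len)

  enumBelow-Selected : ∀ b u → Selected (u , b) →
                       ∃[ ns ] EnumBelow Member (slot b u) ns × length ns ≡ suc u
  enumBelow-Selected false u (dec , _) = enumBelow-slot u dec
  enumBelow-Selected true  u (dec , φ) with enumBelow-slot u dec
  ... | ns , e , len = ns , enumBelow-skip e (¬Member-slot-false φ) , len

  enumBelow-Member : ∀ k → Member k → ∃[ ns ] EnumBelow Member k ns × length ns ≡ rank k
  enumBelow-Member zero    _   = [] , enumBelow-zero , refl
  enumBelow-Member (suc m) mem with halve m | halve-correct m
  ... | u , b | refl with enumBelow-Selected b u mem
  ...   | ns , e , len = ns , e , trans len (sym (rank-slot b u))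

  Chosen-rankable : FRECRankable Chosen
  Chosen-rankable = ranking , ranking-FREC , ranks
    where
    ranks : IsRankingFunction ranking Chosen
    ranks x mem with enumBelow-Member (enc x) mem
    ... | ns , e , len =
      rank (enc x) , subst (IsIth Chosen x) len (enumBelow⇒IsIth mem e) , IsIth-Full-fromℕ (rank (enc x))

  Chosen-not-arithmetical : (∀ p → ∃[ u ] (Φ u ⇔ SatΣ p (slot false u))) → ¬ Arithmetical Chosen
  Chosen-not-arithmetical diagonal (n , c , _ , defines) with diagonal (n , c)
  ... | u , Φ⇔sat = ¬[P⇔Q×¬P] (¬¬Decided u) (mk⇔ to from)
    where
    Member⇔sat : Member (slot false u) ⇔ SatΣ (n , c) (slot false u)
    Member⇔sat = subst (λ k → Member k ⇔ SatΣ (n , c) k) (enc-fromℕ (slot false u))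
      (defines (fromℕ (slot false u)))
    to : SatΣ (n , c) (slot false u) → Decided u × ¬ SatΣ (n , c) (slot false u)
    to sat = map₂ (_∘ Equivalence.from Φ⇔sat)
      (subst id (Member-slot false u) (Equivalence.from Member⇔sat sat))
    from : Decided u × ¬ SatΣ (n , c) (slot false u) → SatΣ (n , c) (slot false u)
    from (dec , ¬sat) = Equivalence.to Member⇔sat
      (Member-slot⁺ false u (dec , ¬sat ∘ Equivalence.to Φ⇔sat))

unary : ℕ → Str → Str
unary zero    r = false ∷ r
unary (suc n) r = true ∷ unary n r

unary-injective : ∀ a b {r s} → unary a r ≡ unary b s → a ≡ b × r ≡ s
unary-injective zero    zero    refl = refl , refl
unary-injective (suc a) (suc b) eq with unary-injective a b (∷-injectiveʳ eq)
... | refl , r≡s = refl , r≡s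

unary-injectiveʳ : ∀ a {r s} → unary a r ≡ unary a s → r ≡ s
unary-injectiveʳ a = proj₂ ∘ unary-injective a a

-- encodeCode c r is a prefix code for c followed by r.
mutual
  encodeCode : ∀ {n} → Code n → Str → Str
  encodeCode zer                 r = unary 0 r
  encodeCode sucᶜ                r = unary 1 r
  encodeCode (proj i)            r = unary 2 (unary (toℕ i) r)
  encodeCode (comp {m = m} f gs) r = unary 3 (unary m (encodeCode f (encodeCodes gs r)))
  encodeCode (prec g h)          r = unary 4 (encodeCode g (encodeCode h r))
  encodeCode (mu f)              r = unary 5 (encodeCode f r)

  encodeCodes : ∀ {n m} → Vec (Code n) m → Str → Str
  encodeCodes []       r = r
  encodeCodes (g ∷ gs) r = encodeCode g (encodeCodes gs r)

mutual
  encodeCode-injective : ∀ {n} (c c′ : Code n) {r s} →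
                         encodeCode c r ≡ encodeCode c′ s → c ≡ c′ × r ≡ s
  encodeCode-injective zer  zer  refl = refl , refl
  encodeCode-injective sucᶜ sucᶜ refl = refl , refl
  encodeCode-injective (proj i) (proj i′) eq
    with unary-injective (toℕ i) (toℕ i′) (unary-injectiveʳ 2 eq)
  ... | i≡i′ , r≡s rewrite toℕ-injective i≡i′ = refl , r≡s
  encodeCode-injective (comp {m = m} f gs) (comp {m = m′} f′ gs′) eq
    with unary-injective m m′ (unary-injectiveʳ 3 eq)
  ... | refl , eq₁ with encodeCode-injective f f′ eq₁
  ...   | refl , eq₂ with encodeCodes-injective gs gs′ eq₂
  ...     | refl , r≡s = refl , r≡s
  encodeCode-injective (prec g h) (prec g′ h′) eq
    with encodeCode-injective g g′ (unary-injectiveʳ 4 eq)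
  ... | refl , eq₁ with encodeCode-injective h h′ eq₁
  ...   | refl , r≡s = refl , r≡s
  encodeCode-injective (mu f) (mu f′) eq with encodeCode-injective f f′ (unary-injectiveʳ 5 eq)
  ... | refl , r≡s = refl , r≡s
  encodeCode-injective zer        sucᶜ         ()
  encodeCode-injective zer        (proj _)     ()
  encodeCode-injective zer        (comp _ _)   ()
  encodeCode-injective zer        (prec _ _)   ()
  encodeCode-injective zer        (mu _)       ()
  encodeCode-injective sucᶜ       zer          ()
  encodeCode-injective sucᶜ       (proj _)     ()
  encodeCode-injective sucᶜ       (comp _ _)   ()
  encodeCode-injective sucᶜ       (prec _ _)   ()
  encodeCode-injective sucᶜ       (mu _)       ()
  encodeCode-injective (proj _)   zer          ()
  encodeCode-injective (proj _)   sucᶜ         ()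
  encodeCode-injective (proj _)   (comp _ _)   ()
  encodeCode-injective (proj _)   (prec _ _)   ()
  encodeCode-injective (proj _)   (mu _)       ()
  encodeCode-injective (comp _ _) zer          ()
  encodeCode-injective (comp _ _) sucᶜ         ()
  encodeCode-injective (comp _ _) (proj _)     ()
  encodeCode-injective (comp _ _) (prec _ _)   ()
  encodeCode-injective (comp _ _) (mu _)       ()
  encodeCode-injective (prec _ _) zer          ()
  encodeCode-injective (prec _ _) sucᶜ         ()
  encodeCode-injective (prec _ _) (proj _)     ()
  encodeCode-injective (prec _ _) (comp _ _)   ()
  encodeCode-injective (prec _ _) (mu _)       ()
  encodeCode-injective (mu _)     zer          ()
  encodeCode-injective (mu _)     sucᶜ         ()
  encodeCode-injective (mu _)     (proj _)     ()
  encodeCode-injective (mu _)     (comp _ _)   ()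
  encodeCode-injective (mu _)     (prec _ _)   ()

  encodeCodes-injective : ∀ {n m} (gs gs′ : Vec (Code n) m) {r s} →
                          encodeCodes gs r ≡ encodeCodes gs′ s → gs ≡ gs′ × r ≡ s
  encodeCodes-injective []       []         eq = refl , eq
  encodeCodes-injective (g ∷ gs) (g′ ∷ gs′) eq with encodeCode-injective g g′ eq
  ... | refl , eq₁ with encodeCodes-injective gs gs′ eq₁
  ...   | refl , r≡s = refl , r≡s

Program : Set
Program = Σ ℕ (λ n → Code (suc n))

encodeProgram : Program → Str
encodeProgram (n , c) = unary n (encodeCode c [])

encodeProgram-injective : ∀ p q → encodeProgram p ≡ encodeProgram q → p ≡ q
encodeProgram-injective (n , c) (n′ , c′) eq with unary-injective n n′ eq
... | refl , eq₁ with encodeCode-injective c c′ eq₁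
...   | refl , _ = refl

-- 2u+1 = slot false u is the number whose membership in the selection is ¬ Φ u.
SelfAccepting : ℕ → Set
SelfAccepting u = ∃[ p ] encodeProgram p ≡ fromℕ u × SatΣ p (slot false u)

SelfAccepting-diagonal : ∀ p → let u = enc (encodeProgram p) in SelfAccepting u ⇔ SatΣ p (slot false u)
SelfAccepting-diagonal p = mk⇔ to from
  where
  u = enc (encodeProgram p)
  to : SelfAccepting u → SatΣ p (slot false u)
  to (q , q≡u , sat) =
    subst (λ q → SatΣ q (slot false u)) (encodeProgram-injective q p (trans q≡u (fromℕ-enc _))) sat
  from : SatΣ p (slot false u) → SelfAccepting u
  from sat = p , sym (fromℕ-enc _) , sat

corollary7 : Σ (Str → Set) (λ A → ¬ Arithmetical A × FRECRankable A)
corollary7 = Chosen , Chosen-not-arithmetical diagonal , Chosen-rankable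
  where
  open Selection SelfAccepting
  diagonal : ∀ p → ∃[ u ] (SelfAccepting u ⇔ SatΣ p (slot false u))
  diagonal p = enc (encodeProgram p) , SelfAccepting-diagonal p
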